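{- Let $G=(V(G),E(G))$ be a finite simple graph and let $t,n$ be positive integers such that $n-t\ge 0$ and $n-t$ is even. For every vertex $x\in V(G)$ and $1\le i\le n$, $$d_{Shu^t_n(G)}(x_i)=\begin{cases} d_G(x)(n-1)+|V(G)|, & \text{if } 1\le i\le t,\\ d_G(x)(n-1)+|V(G)|+1, & \text{if } t+1\le i\le n,\end{cases}$$ and $$d_{Shu^t_n(G)}(z_i)=\begin{cases} |V(G)|, & \text{if } 1\le i\le t,\\ |V(G)|+1, & \text{if } t+1\le i\le n.\end{cases}$$
   Context: The $(t,n)$-shuriken graph $Shu^t_n(G)$ (for positive integers $t,n$ with $n-t\ge 0$ even) is the simple graph constructed as follows. Add a new vertex $z$ to $G$ and take $n$ copies $G'_1,\dots,G'_n$ of the resulting vertex set $V(G)\cup\{z\}$; for $x\in V(G)\cup\{z\}$ and $1\le i\le n$, write $x_i$ for the copy of $x$ in $G'_i$. The vertex set is $\bigcup_{i=1}^n\{z_i, v_i : v\in V(G)\}$. The edge set consists of: (1) $u_iv_j$ for every edge $uv\in E(G)$ and all $i,j\in\{1,\dots,n\}$ (including $i=j$); (2) for each $i\in\{1,\dots,t\}$, all edges $u_iv_i$ between distinct vertices $u_i\neq v_i$ of $G'_i$; (3) for each $i\in\{t+1,\dots,\frac{n+t}{2}\}$, all edges $u_iv_{n+t+1-i}$ with $u_i\in V(G'_i)$ and $v_{n+t+1-i}\in V(G'_{n+t+1-i})$. $d_H(v)$ denotes the degree of vertex $v$ in graph $H$. -}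

module Defs where

open import Data.Nat using (ℕ; zero; suc; _+_; _∸_; _≤?_; _<?_)
open import Data.Nat.DivMod using (_/_)
open import Data.Fin using (Fin; toℕ; _≟_)
open import Data.Bool using (Bool; true; false; _∧_; _∨_; not)
open import Data.Maybe using (Maybe; just; nothing)
open import Data.Product using (_×_; _,_)
open import Data.List using (List; []; _∷_; map; filter; length; cartesianProduct)
open import Data.List using () renaming (allFin to allFinL)
open import Relation.Nullary.Decidable using (⌊_⌋)
open import Relation.Binary.PropositionalEquality using (_≡_)
open import Data.Bool.Properties using () renaming (_≟_ to _≟B_)

-- A finite simple graph on vertex set Fin m is given by a Boolean
-- adjacency matrix A (symmetry and irreflexivity are hypotheses of the theorem).

degG : {m : ℕ} → (Fin m → Fin m → Bool) → Fin m → ℕ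
degG {m} A u = length (filter (λ v → A u v ≟B true) (allFinL m))

-- vertex set of Shu^t_n(G): pairs (i , a) where i : Fin n is the copy index
-- (copy number toℕ i + 1) and a = just x stands for x_i, a = nothing for z_i.
ShuVertex : ℕ → ℕ → Set
ShuVertex m n = Fin n × Maybe (Fin m)

shuVertices : (m n : ℕ) → List (ShuVertex m n)
shuVertices m n = cartesianProduct (allFinL n) (nothing ∷ map just (allFinL m))

eqMaybe : {m : ℕ} → Maybe (Fin m) → Maybe (Fin m) → Bool
eqMaybe nothing nothing = true
eqMaybe nothing (just _) = false
eqMaybe (just _) nothing = false
eqMaybe (just x) (just y) = ⌊ x ≟ y ⌋

edge1 : {m : ℕ} → (Fin m → Fin m → Bool) → Maybe (Fin m) → Maybe (Fin m) → Bool
edge1 A (just u) (just v) = A u v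
edge1 A _ _ = false

-- type (3) with I = copy number of the first vertex, J of the second:
-- t+1 ≤ I ≤ (n+t)/2 and J = n+t+1-I
pairCond : (t n I J : ℕ) → Bool
pairCond t n I J = ⌊ t <? I ⌋ ∧ ⌊ I ≤? (n + t) / 2 ⌋ ∧ ⌊ J Data.Nat.≟ (n + t + 1 ∸ I) ⌋

shuAdj : {m : ℕ} → (Fin m → Fin m → Bool) → (t n : ℕ) →
         ShuVertex m n → ShuVertex m n → Bool
shuAdj A t n (i , a) (j , b) =
  not (⌊ i ≟ j ⌋ ∧ eqMaybe a b) ∧
  ( edge1 A a b
  ∨ (⌊ i ≟ j ⌋ ∧ ⌊ suc (toℕ i) ≤? t ⌋)
  ∨ pairCond t n (suc (toℕ i)) (suc (toℕ j))
  ∨ pairCond t n (suc (toℕ j)) (suc (toℕ i)))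

shuDeg : {m : ℕ} → (Fin m → Fin m → Bool) → (t n : ℕ) → ShuVertex m n → ℕ
shuDeg {m} A t n w = length (filter (λ w' → shuAdj A t n w w' ≟B true) (shuVertices m n))

{-# OPTIONS --safe #-}
-- The neighbours of (i , a) in copy j are the G-neighbours of a, unless copy j is
-- joined to copy i completely: j = i for copies up to t (everything but (i , a)
-- itself, m vertices) or j the partner n + t + 1 − i of a copy above t (all m + 1
-- vertices). As n + t is even, no copy is its own partner, so every copy above t
-- has exactly one partner and the copies up to t have none. Summing over the n
-- copies, n − 1 of them contribute d_G(a) and one contributes m or m + 1.
module Submission where

open import Defs
open import Data.Nat using (ℕ; zero; suc; _+_; _*_; _∸_; _≤_; _<_; _≤?_; _<?_)
  renaming (_≟_ to _≟ℕ_)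
open import Data.Nat.Properties hiding (_≟_)
open import Data.Nat.Divisibility using (_∣_; ∣m∣n⇒∣m+n; ∣m+n∣m⇒∣n; ∣1⇒≡1; m∣m*n)
open import Data.Nat.DivMod using (_/_; m*[n/m]≡n; m/n≤m)
open import Data.Nat.ListAction using (sum)
open import Data.Fin using (Fin; toℕ; fromℕ<; _≟_) renaming (zero to fzero; suc to fsuc)
open import Data.Fin.Properties using (toℕ<n; toℕ-fromℕ<; toℕ-injective)
  renaming (suc-injective to fsuc-injective)
open import Data.Bool using (Bool; true; false; _∧_; _∨_; not)
open import Data.Bool.Properties using (¬-not; ∧-zeroʳ; ∧-identityʳ; ∨-zeroʳ; ∨-identityʳ)
  renaming (_≟_ to _≟B_)
open import Data.Maybe using (Maybe; just; nothing)
open import Data.Product using (_×_; _,_; ∃-syntax)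
open import Data.Sum using (inj₁; inj₂)
open import Data.List using (List; []; _∷_; _++_; map; filter; length; tabulate; cartesianProduct)
  renaming (allFin to allFinL)
open import Data.List.Properties
  using (filter-++; filter-≐; filter-all; filter-none; length-++; length-map; length-tabulate;
         map-tabulate; map-cong)
open import Data.List.Relation.Unary.All using (universal)
open import Function using (_∘_; id)
open import Relation.Nullary using (Dec; yes; no; ¬_; contradiction)
open import Relation.Nullary.Decidable using (⌊_⌋; isYes≗does; dec-true; dec-false; ⌊⌋-map′)
open import Relation.Binary.PropositionalEquality

-- The count used by degG and shuDeg in Defs, so that both unfold to countᵇ.
countᵇ : {X : Set} → (X → Bool) → List X → ℕ
countᵇ p xs = length (filter (λ x → p x ≟B true) xs)

private
  variable
    X Y : Set

countᵇ-cong : {p q : X → Bool} → p ≗ q → countᵇ p ≗ countᵇ q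
countᵇ-cong {p = p} {q = q} p≗q xs = cong length
  (filter-≐ (λ x → p x ≟B true) (λ x → q x ≟B true)
    ((λ {x} → trans (sym (p≗q x))) , (λ {x} → trans (p≗q x))) xs)

countᵇ-++ : (p : X → Bool) (xs ys : List X) → countᵇ p (xs ++ ys) ≡ countᵇ p xs + countᵇ p ys
countᵇ-++ p xs ys = trans (cong length (filter-++ p? xs ys)) (length-++ (filter p? xs))
  where p? = λ x → p x ≟B true

countᵇ-true : (xs : List X) → countᵇ (λ _ → true) xs ≡ length xs
countᵇ-true xs = cong length (filter-all (λ _ → true ≟B true) (universal (λ _ → refl) xs))

countᵇ-false : (xs : List X) → countᵇ (λ _ → false) xs ≡ 0
countᵇ-false xs = cong length (filter-none (λ _ → false ≟B true) (universal (λ _ ()) xs))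

countᵇ-map : (p : Y → Bool) (f : X → Y) (xs : List X) → countᵇ p (map f xs) ≡ countᵇ (p ∘ f) xs
countᵇ-map p f []       = refl
countᵇ-map p f (x ∷ xs) with p (f x)
... | true  = cong suc (countᵇ-map p f xs)
... | false = countᵇ-map p f xs

countᵇ-cartesianProduct : (p : X × Y → Bool) (xs : List X) (ys : List Y) →
  countᵇ p (cartesianProduct xs ys) ≡ sum (map (λ x → countᵇ (λ y → p (x , y)) ys) xs)
countᵇ-cartesianProduct p []       ys = refl
countᵇ-cartesianProduct p (x ∷ xs) ys = trans (countᵇ-++ p (map (x ,_) ys) _)
  (cong₂ _+_ (countᵇ-map p (x ,_) ys) (countᵇ-cartesianProduct p xs ys))

allFin-suc : ∀ n → allFinL (suc n) ≡ fzero ∷ map fsuc (allFinL n)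
allFin-suc n = cong (fzero ∷_) (sym (map-tabulate id fsuc))

countᵇ-≢ : ∀ {m} (x : Fin m) → suc (countᵇ (λ v → not ⌊ x ≟ v ⌋) (allFinL m)) ≡ m
countᵇ-≢ {suc m} fzero = begin
  suc (countᵇ (λ v → not ⌊ fzero ≟ v ⌋) (allFinL (suc m)))
    ≡⟨ cong (λ vs → suc (countᵇ (λ v → not ⌊ fzero ≟ v ⌋) vs)) (allFin-suc m) ⟩
  suc (countᵇ (λ v → not ⌊ fzero ≟ v ⌋) (map fsuc (allFinL m)))
    ≡⟨ cong suc (countᵇ-map (λ v → not ⌊ fzero ≟ v ⌋) fsuc (allFinL m)) ⟩
  suc (countᵇ (λ _ → true) (allFinL m))
    ≡⟨ cong suc (trans (countᵇ-true (allFinL m)) (length-tabulate id)) ⟩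
  suc m ∎
  where open ≡-Reasoning
countᵇ-≢ {suc m} (fsuc x) = begin
  suc (countᵇ (λ v → not ⌊ fsuc x ≟ v ⌋) (allFinL (suc m)))
    ≡⟨ cong (λ vs → suc (countᵇ (λ v → not ⌊ fsuc x ≟ v ⌋) vs)) (allFin-suc m) ⟩
  suc (suc (countᵇ (λ v → not ⌊ fsuc x ≟ v ⌋) (map fsuc (allFinL m))))
    ≡⟨ cong (suc ∘ suc) (countᵇ-map (λ v → not ⌊ fsuc x ≟ v ⌋) fsuc (allFinL m)) ⟩
  suc (suc (countᵇ (λ v → not ⌊ fsuc x ≟ fsuc v ⌋) (allFinL m)))
    ≡⟨ cong (suc ∘ suc) (countᵇ-cong (λ v → cong not (⌊⌋-map′ _ _ (x ≟ v))) (allFinL m)) ⟩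
  suc (suc (countᵇ (λ v → not ⌊ x ≟ v ⌋) (allFinL m)))
    ≡⟨ cong suc (countᵇ-≢ x) ⟩
  suc m ∎
  where open ≡-Reasoning

sum-tabulate-const : ∀ {n} {D} (h : Fin n → ℕ) → (∀ j → h j ≡ D) → sum (tabulate h) ≡ n * D
sum-tabulate-const {zero}  h h≡D = refl
sum-tabulate-const {suc n} h h≡D = cong₂ _+_ (h≡D fzero) (sum-tabulate-const (h ∘ fsuc) (h≡D ∘ fsuc))

sum-tabulate-except : ∀ {n} {D} (h : Fin n → ℕ) (k : Fin n) → (∀ j → j ≢ k → h j ≡ D) →
                      sum (tabulate h) ≡ (n ∸ 1) * D + h k
sum-tabulate-except {suc n} {D} h fzero h≡D =
  trans (cong (h fzero +_) (sum-tabulate-const (h ∘ fsuc) (λ j → h≡D (fsuc j) (λ ()))))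
        (+-comm (h fzero) (n * D))
sum-tabulate-except {suc (suc n)} {D} h (fsuc k) h≡D = begin
  h fzero + sum (tabulate (h ∘ fsuc))
    ≡⟨ cong₂ _+_ (h≡D fzero (λ ())) (sum-tabulate-except (h ∘ fsuc) k h∘fsuc≡D) ⟩
  D + (n * D + h (fsuc k))
    ≡⟨ +-assoc D (n * D) (h (fsuc k)) ⟨
  suc n * D + h (fsuc k) ∎
  where
    open ≡-Reasoning
    h∘fsuc≡D : ∀ j → j ≢ k → h (fsuc j) ≡ D
    h∘fsuc≡D j j≢k = h≡D (fsuc j) (j≢k ∘ fsuc-injective)

isYes-true : ∀ {P : Set} (p? : Dec P) → P → ⌊ p? ⌋ ≡ true
isYes-true p? p = trans (isYes≗does p?) (dec-true p? p)

isYes-false : ∀ {P : Set} (p? : Dec P) → ¬ P → ⌊ p? ⌋ ≡ false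
isYes-false p? ¬p = trans (isYes≗does p?) (dec-false p? ¬p)

2∣m+m : ∀ m → 2 ∣ m + m
2∣m+m m = subst (2 ∣_) (cong (m +_) (+-identityʳ m)) (m∣m*n m)

2∣m∸n⇒2∣m+n : ∀ {m n} → n ≤ m → 2 ∣ m ∸ n → 2 ∣ m + n
2∣m∸n⇒2∣m+n {m} {n} n≤m 2∣m∸n = subst (2 ∣_) m∸n+[n+n]≡m+n (∣m∣n⇒∣m+n 2∣m∸n (2∣m+m n))
  where
    m∸n+[n+n]≡m+n : m ∸ n + (n + n) ≡ m + n
    m∸n+[n+n]≡m+n = trans (sym (+-assoc (m ∸ n) n n)) (cong (_+ n) (m∸n+n≡m n≤m))

half+half : ∀ {m} → 2 ∣ m → m / 2 + m / 2 ≡ m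
half+half {m} 2∣m = trans (cong (m / 2 +_) (sym (+-identityʳ (m / 2)))) (m*[n/m]≡n 2∣m)

even⇒double≢suc : ∀ {m} → 2 ∣ m → ∀ k → k + k ≢ m + 1
even⇒double≢suc {m} 2∣m k k+k≡m+1 = contradiction (∣1⇒≡1 2∣1) λ ()
  where
    2∣1 : 2 ∣ 1
    2∣1 = ∣m+n∣m⇒∣n (subst (2 ∣_) k+k≡m+1 (2∣m+m k)) 2∣m

partnered : (t n I J : ℕ) → Bool
partnered t n I J = pairCond t n I J ∨ pairCond t n J I

module _ (t n : ℕ) where

  pairSum⇒t< : ∀ {I J} → I + J ≡ n + t + 1 → J ≤ n → t < I
  pairSum⇒t< {I} {J} I+J≡ J≤n = +-cancelʳ-≤ n (suc t) I (begin
    suc t + n    ≡⟨ cong suc (+-comm t n) ⟩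
    suc (n + t)  ≡⟨ +-comm 1 (n + t) ⟩
    n + t + 1    ≡⟨ I+J≡ ⟨
    I + J        ≤⟨ +-monoʳ-≤ I J≤n ⟩
    I + n        ∎)
    where open ≤-Reasoning

  pairCond-intro : ∀ {I J} → t < I → I ≤ (n + t) / 2 → I + J ≡ n + t + 1 → pairCond t n I J ≡ true
  pairCond-intro {I} {J} t<I I≤h I+J≡
    rewrite isYes-true (t <? I) t<I
          | isYes-true (I ≤? (n + t) / 2) I≤h
          | isYes-true (J ≟ℕ n + t + 1 ∸ I) (trans (sym (m+n∸m≡n I J)) (cong (_∸ I) I+J≡))
          = refl

  pairCond-sound : ∀ {I J} → pairCond t n I J ≡ true → I + J ≡ n + t + 1
  pairCond-sound {I} {J} p with t <? I | I ≤? (n + t) / 2 | J ≟ℕ n + t + 1 ∸ I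
  ... | yes _ | yes I≤h | yes refl =
    m+[n∸m]≡n (≤-trans I≤h (≤-trans (m/n≤m (n + t) 2) (m≤m+n (n + t) 1)))
  ... | no _  | _     | _     = contradiction p λ ()
  ... | yes _ | no _  | _     = contradiction p λ ()
  ... | yes _ | yes _ | no _  = contradiction p λ ()

  partnered-sound : ∀ {I J} → partnered t n I J ≡ true → I + J ≡ n + t + 1
  partnered-sound {I} {J} p with pairCond t n I J in IJ
  ... | true  = pairCond-sound {I} {J} IJ
  ... | false = trans (+-comm I J) (pairCond-sound {J} {I} p)

  pairSum⇒≤half : ∀ {I J} → 2 ∣ n + t → (n + t) / 2 < I → I + J ≡ n + t + 1 → J ≤ (n + t) / 2
  pairSum⇒≤half {I} {J} 2∣n+t h<I I+J≡ = +-cancelˡ-≤ h J h (≤-pred (begin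
    suc h + J    ≤⟨ +-monoˡ-≤ J h<I ⟩
    I + J        ≡⟨ I+J≡ ⟩
    n + t + 1    ≡⟨ +-comm (n + t) 1 ⟩
    suc (n + t)  ≡⟨ cong suc (half+half 2∣n+t) ⟨
    suc (h + h)  ∎))
    where
      open ≤-Reasoning
      h = (n + t) / 2

  partnered-complete : ∀ {I J} → 2 ∣ n + t → I ≤ n → J ≤ n → I + J ≡ n + t + 1 →
                       partnered t n I J ≡ true
  partnered-complete {I} {J} 2∣n+t I≤n J≤n I+J≡ with ≤-<-connex I ((n + t) / 2)
  ... | inj₁ I≤h = cong (_∨ pairCond t n J I) (pairCond-intro (pairSum⇒t< I+J≡ J≤n) I≤h I+J≡)
  ... | inj₂ h<I = trans (cong (pairCond t n I J ∨_) (pairCond-intro (pairSum⇒t< J+I≡ I≤n) J≤h J+I≡))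
                        (∨-zeroʳ (pairCond t n I J))
    where
      J+I≡ : J + I ≡ n + t + 1
      J+I≡ = trans (+-comm J I) I+J≡
      J≤h : J ≤ (n + t) / 2
      J≤h = pairSum⇒≤half 2∣n+t h<I I+J≡

  partneredCopies : Fin n → Fin n → Bool
  partneredCopies i j = partnered t n (suc (toℕ i)) (suc (toℕ j))

  Partners : Fin n → Fin n → Set
  Partners i j = suc (toℕ i) + suc (toℕ j) ≡ n + t + 1

  Partners⇒partnered : ∀ {i j} → 2 ∣ n + t → Partners i j → partneredCopies i j ≡ true
  Partners⇒partnered {i} {j} 2∣n+t = partnered-complete 2∣n+t (toℕ<n i) (toℕ<n j)

  ¬Partners⇒¬partnered : ∀ {i j} → ¬ Partners i j → partneredCopies i j ≡ false
  ¬Partners⇒¬partnered {i} {j} ¬p = ¬-not (¬p ∘ partnered-sound {suc (toℕ i)} {suc (toℕ j)})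

  low⇒¬Partners : ∀ {i j} → toℕ i < t → ¬ Partners i j
  low⇒¬Partners {i} {j} i<t p = 1+n≰n (begin
    suc (t + n)                ≡⟨ cong suc (+-comm t n) ⟩
    suc (n + t)                ≡⟨ +-comm 1 (n + t) ⟩
    n + t + 1                  ≡⟨ p ⟨
    suc (toℕ i) + suc (toℕ j)  ≤⟨ +-mono-≤ i<t (toℕ<n j) ⟩
    t + n                      ∎)
    where open ≤-Reasoning

  Partners-irrefl : ∀ {i} → 2 ∣ n + t → ¬ Partners i i
  Partners-irrefl {i} 2∣n+t = even⇒double≢suc 2∣n+t (suc (toℕ i))

  Partners-unique : ∀ {i j k} → Partners i j → Partners i k → j ≡ k
  Partners-unique {i} pj pk =
    toℕ-injective (suc-injective (+-cancelˡ-≡ (suc (toℕ i)) _ _ (trans pj (sym pk))))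

  high⇒∃Partners : ∀ i → t ≤ toℕ i → ∃[ k ] Partners i k
  high⇒∃Partners i t≤i = fromℕ< r<n , (begin
    suc (toℕ i) + suc (toℕ (fromℕ< r<n))  ≡⟨ cong (λ x → suc (toℕ i) + suc x) (toℕ-fromℕ< r<n) ⟩
    suc (toℕ i) + suc r                   ≡⟨ +-suc (suc (toℕ i)) r ⟩
    suc (suc (toℕ i) + r)                 ≡⟨ cong suc (trans (+-comm (suc (toℕ i)) r) r+I≡n+t) ⟩
    suc (n + t)                           ≡⟨ +-comm 1 (n + t) ⟩
    n + t + 1                             ∎)
    where
      r = n + t ∸ suc (toℕ i)
      r+I≡n+t : r + suc (toℕ i) ≡ n + t
      r+I≡n+t = m∸n+n≡m (≤-trans (toℕ<n i) (m≤m+n n t))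
      r<n : r < n
      r<n = +-cancelʳ-< (suc (toℕ i)) r n (begin-strict
        r + suc (toℕ i)  ≡⟨ r+I≡n+t ⟩
        n + t            ≤⟨ +-monoʳ-≤ n t≤i ⟩
        n + toℕ i        <⟨ +-monoʳ-< n (n<1+n (toℕ i)) ⟩
        n + suc (toℕ i)  ∎)
        where open ≤-Reasoning
      open ≡-Reasoning

module _ {m : ℕ} (A : Fin m → Fin m → Bool) where

  degG+z : Maybe (Fin m) → ℕ
  degG+z nothing  = 0
  degG+z (just x) = degG A x

  copyVertices : List (Maybe (Fin m))
  copyVertices = nothing ∷ map just (allFinL m)

  countᵇ-edge1 : ∀ a → countᵇ (edge1 A a) copyVertices ≡ degG+z a
  countᵇ-edge1 nothing  = countᵇ-false copyVertices
  countᵇ-edge1 (just x) = countᵇ-map (edge1 A (just x)) just (allFinL m)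

  countᵇ-all : countᵇ (λ _ → true) copyVertices ≡ m + 1
  countᵇ-all = begin
    countᵇ (λ _ → true) copyVertices     ≡⟨ countᵇ-true copyVertices ⟩
    suc (length (map just (allFinL m)))  ≡⟨ cong suc (length-map just (allFinL m)) ⟩
    suc (length (allFinL m))             ≡⟨ cong suc (length-tabulate id) ⟩
    suc m                                ≡⟨ +-comm 1 m ⟩
    m + 1                                ∎
    where open ≡-Reasoning

  countᵇ-distinct : ∀ a → countᵇ (λ b → not (eqMaybe a b)) copyVertices ≡ m
  countᵇ-distinct nothing = begin
    countᵇ (λ b → not (eqMaybe nothing b)) (map just (allFinL m))  ≡⟨ countᵇ-map _ just (allFinL m) ⟩
    countᵇ (λ _ → true) (allFinL m)                                ≡⟨ countᵇ-true (allFinL m) ⟩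
    length (allFinL m)                                             ≡⟨ length-tabulate id ⟩
    m                                                              ∎
    where open ≡-Reasoning
  countᵇ-distinct (just x) =
    trans (cong suc (countᵇ-map (λ b → not (eqMaybe (just x) b)) just (allFinL m))) (countᵇ-≢ x)

  rowDegree : Bool → Bool → Maybe (Fin m) → ℕ
  rowDegree _     false a = degG+z a
  rowDegree true  true  _ = m
  rowDegree false true  _ = m + 1

  module _ (irreflexive : ∀ u → A u u ≡ false) where

    edge1-distinct : ∀ a b → not (eqMaybe a b) ∧ edge1 A a b ≡ edge1 A a b
    edge1-distinct (just x) (just y) with x ≟ y
    ... | yes refl = sym (irreflexive x)
    ... | no _     = refl
    edge1-distinct (just x) nothing = refl
    edge1-distinct nothing  b       = ∧-zeroʳ (not (eqMaybe nothing b))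

    countᵇ-row : ∀ same joined a →
                 countᵇ (λ b → not (same ∧ eqMaybe a b) ∧ (edge1 A a b ∨ joined)) copyVertices ≡
                 rowDegree same joined a
    countᵇ-row false false a =
      trans (countᵇ-cong (λ b → ∨-identityʳ (edge1 A a b)) copyVertices) (countᵇ-edge1 a)
    countᵇ-row true false a = trans (countᵇ-cong only-edges copyVertices) (countᵇ-edge1 a)
      where
        only-edges : ∀ b → not (eqMaybe a b) ∧ (edge1 A a b ∨ false) ≡ edge1 A a b
        only-edges b = trans (cong (not (eqMaybe a b) ∧_) (∨-identityʳ (edge1 A a b))) (edge1-distinct a b)
    countᵇ-row true true a = trans (countᵇ-cong all-but-a copyVertices) (countᵇ-distinct a)
      where
        all-but-a : ∀ b → not (eqMaybe a b) ∧ (edge1 A a b ∨ true) ≡ not (eqMaybe a b)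
        all-but-a b = trans (cong (not (eqMaybe a b) ∧_) (∨-zeroʳ (edge1 A a b))) (∧-identityʳ _)
    countᵇ-row false true a =
      trans (countᵇ-cong (λ b → ∨-zeroʳ (edge1 A a b)) copyVertices) countᵇ-all

    module Degrees (t n : ℕ) where

      copiesJoined : Fin n → Fin n → Bool
      copiesJoined i j = (⌊ i ≟ j ⌋ ∧ ⌊ suc (toℕ i) ≤? t ⌋) ∨ partneredCopies t n i j

      degInCopy : Fin n → Maybe (Fin m) → Fin n → ℕ
      degInCopy i a j = rowDegree ⌊ i ≟ j ⌋ (copiesJoined i j) a

      -- Restricted to copy j, shuAdj A t n (i , a) is literally the predicate of
      -- countᵇ-row with same = ⌊ i ≟ j ⌋ and joined = copiesJoined i j.
      shuDeg-sum : ∀ i a → shuDeg A t n (i , a) ≡ sum (tabulate (degInCopy i a))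
      shuDeg-sum i a = begin
        shuDeg A t n (i , a)
          ≡⟨ countᵇ-cartesianProduct (shuAdj A t n (i , a)) (allFinL n) copyVertices ⟩
        sum (map (λ j → countᵇ (λ b → shuAdj A t n (i , a) (j , b)) copyVertices) (allFinL n))
          ≡⟨ cong sum (map-cong (λ j → countᵇ-row ⌊ i ≟ j ⌋ (copiesJoined i j) a) (allFinL n)) ⟩
        sum (map (degInCopy i a) (allFinL n))
          ≡⟨ cong sum (map-tabulate id (degInCopy i a)) ⟩
        sum (tabulate (degInCopy i a)) ∎
        where open ≡-Reasoning

      degInCopy-self : ∀ i a → degInCopy i a i ≡
                       rowDegree true (⌊ suc (toℕ i) ≤? t ⌋ ∨ partneredCopies t n i i) a
      degInCopy-self i a rewrite isYes-true (i ≟ i) refl = refl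

      degInCopy-other : ∀ {i j} a → i ≢ j →
                        degInCopy i a j ≡ rowDegree false (partneredCopies t n i j) a
      degInCopy-other {i} {j} a i≢j rewrite isYes-false (i ≟ j) i≢j = refl

      shuDeg-low : ∀ {i} a → toℕ i < t → shuDeg A t n (i , a) ≡ degG+z a * (n ∸ 1) + m
      shuDeg-low {i} a i<t = begin
        shuDeg A t n (i , a)                  ≡⟨ shuDeg-sum i a ⟩
        sum (tabulate (degInCopy i a))        ≡⟨ sum-tabulate-except (degInCopy i a) i others ⟩
        (n ∸ 1) * degG+z a + degInCopy i a i  ≡⟨ cong₂ _+_ (*-comm (n ∸ 1) (degG+z a)) self ⟩
        degG+z a * (n ∸ 1) + m                ∎
        where
          open ≡-Reasoning
          self : degInCopy i a i ≡ m
          self = trans (degInCopy-self i a)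
            (cong (λ l → rowDegree true (l ∨ partneredCopies t n i i) a) (isYes-true (suc (toℕ i) ≤? t) i<t))
          others : ∀ j → j ≢ i → degInCopy i a j ≡ degG+z a
          others j j≢i = trans (degInCopy-other a (≢-sym j≢i))
            (cong (λ p → rowDegree false p a) (¬Partners⇒¬partnered t n (low⇒¬Partners t n i<t)))

      shuDeg-high : ∀ {i} a → 2 ∣ n + t → t ≤ toℕ i →
                    shuDeg A t n (i , a) ≡ degG+z a * (n ∸ 1) + (m + 1)
      shuDeg-high {i} a 2∣n+t t≤i with high⇒∃Partners t n i t≤i
      ... | k , i~k = begin
        shuDeg A t n (i , a)                  ≡⟨ shuDeg-sum i a ⟩
        sum (tabulate (degInCopy i a))        ≡⟨ sum-tabulate-except (degInCopy i a) k others ⟩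
        (n ∸ 1) * degG+z a + degInCopy i a k  ≡⟨ cong₂ _+_ (*-comm (n ∸ 1) (degG+z a)) partner ⟩
        degG+z a * (n ∸ 1) + (m + 1)          ∎
        where
          open ≡-Reasoning
          i≢k : i ≢ k
          i≢k refl = Partners-irrefl t n 2∣n+t i~k
          partner : degInCopy i a k ≡ m + 1
          partner = trans (degInCopy-other a i≢k) (cong (λ p → rowDegree false p a)
                                                        (Partners⇒partnered t n 2∣n+t i~k))
          others : ∀ j → j ≢ k → degInCopy i a j ≡ degG+z a
          others j j≢k with j ≟ i
          ... | yes refl = trans (degInCopy-self i a) (cong (λ c → rowDegree true c a)
                  (cong₂ _∨_ (isYes-false (suc (toℕ i) ≤? t) (≤⇒≯ t≤i))
                             (¬Partners⇒¬partnered t n (Partners-irrefl t n 2∣n+t))))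
          ... | no j≢i   = trans (degInCopy-other a (≢-sym j≢i)) (cong (λ p → rowDegree false p a)
                  (¬Partners⇒¬partnered t n (λ i~j → j≢k (Partners-unique t n i~j i~k))))

mainTheorem5 : (m : ℕ) (A : Fin m → Fin m → Bool) →
               (∀ u v → A u v ≡ A v u) → (∀ u → A u u ≡ false) →
               (t n : ℕ) → 1 ≤ t → t ≤ n → 2 ∣ (n ∸ t) →
               ((x : Fin m) (i : Fin n) →
                  (toℕ i < t → shuDeg A t n (i , just x) ≡ degG A x * (n ∸ 1) + m) ×
                  (t ≤ toℕ i → shuDeg A t n (i , just x) ≡ degG A x * (n ∸ 1) + m + 1)) ×
               ((i : Fin n) →
                  (toℕ i < t → shuDeg A t n (i , nothing) ≡ m) ×
                  (t ≤ toℕ i → shuDeg A t n (i , nothing) ≡ m + 1))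
mainTheorem5 m A _ irreflexive t n _ t≤n 2∣n∸t =
    (λ x i → shuDeg-low (just x) ,
             λ t≤i → trans (shuDeg-high (just x) 2∣n+t t≤i) (sym (+-assoc (degG A x * (n ∸ 1)) m 1)))
  , (λ i → shuDeg-low nothing , shuDeg-high nothing 2∣n+t)
  where
    open Degrees A irreflexive t n
    2∣n+t : 2 ∣ n + t
    2∣n+t = 2∣m∸n⇒2∣m+n t≤n 2∣n∸t
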